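{- Let $G=(V,E)$ be a finite simple triangle-free graph and $S=\{v_1,\dots,v_r\}\subseteq V$ an independent set of $r$ distinct vertices. Then $$|V(G)|-|V(G_{v_1,\dots,v_r})|=|B(S;1)|=r+\sum_{i=1}^r d_{G_{v_1,\dots,v_{i-1}}}(v_i),$$ and $$|E(G)|-|E(G_{v_1,\dots,v_r})|=d(B(S;1))-|E_{B(S;1)}|=\sum_{i=1}^r d^2_{G_{v_1,\dots,v_{i-1}}}(v_i).$$
   Context: For an independent set $\{u_1,\dots,u_s\}$, $G_{u_1,\dots,u_s}$ is the subgraph induced on $V\setminus B(\{u_1,\dots,u_s\};1)$, where $B(T;1)$ is the set of vertices at distance at most $1$ from some vertex of $T$; for $i=1$ the graph $G_{v_1,\dots,v_{i-1}}$ is $G$ itself. $d_H(u)$ is the valency of $u$ in $H$, and $d^2_H(u)=\sum_{w} d_H(w)$, summing over the neighbours $w$ of $u$ in $H$. For $W\subseteq V$, $d(W)=\sum_{w\in W}d_G(w)$ and $E_W$ is the set of edges of $G$ with both ends in $W$. -}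

module Defs where

open import Data.Nat using (ℕ; zero; suc; _+_; _<ᵇ_)
open import Data.Fin using (Fin; zero; suc; toℕ; _≟_)
open import Data.Bool using (Bool; true; false; _∧_; _∨_; not; if_then_else_)
open import Relation.Nullary.Decidable using (⌊_⌋)
open import Relation.Binary.PropositionalEquality using (_≡_; _≢_)
open import Data.Empty using (⊥)

record Graph (n : ℕ) : Set where
  field
    adj    : Fin n → Fin n → Bool
    sym    : ∀ x y → adj x y ≡ adj y x
    irrefl : ∀ x → adj x x ≡ false
open Graph public

TriangleFree : ∀ {n} → Graph n → Set
TriangleFree G = ∀ x y z → adj G x y ≡ true → adj G y z ≡ true → adj G x z ≡ true → ⊥

sumFin : ∀ n → (Fin n → ℕ) → ℕ
sumFin zero    f = 0
sumFin (suc n) f = f zero + sumFin n (λ i → f (suc i))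

anyFin : ∀ n → (Fin n → Bool) → Bool
anyFin zero    f = false
anyFin (suc n) f = f zero ∨ anyFin n (λ i → f (suc i))

VSet : ℕ → Set
VSet n = Fin n → Bool

card : ∀ {n} → VSet n → ℕ
card {n} W = sumFin n (λ x → if W x then 1 else 0)

-- B({v_j : j < k}; 1): vertices at distance ≤ 1 from one of the first k vertices of v
ball : ∀ {n r} → Graph n → (Fin r → Fin n) → ℕ → VSet n
ball {n} {r} G v k x =
  anyFin r (λ j → (toℕ j <ᵇ k) ∧ (⌊ x ≟ v j ⌋ ∨ adj G (v j) x))

-- vertex set of G_{v_1,…,v_k} = V ∖ B({v_1,…,v_k};1)
remaining : ∀ {n r} → Graph n → (Fin r → Fin n) → ℕ → VSet n
remaining G v k x = not (ball G v k x)

degIn : ∀ {n} → Graph n → VSet n → Fin n → ℕ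
degIn {n} G W u = sumFin n (λ w → if W w ∧ adj G u w then 1 else 0)

deg2In : ∀ {n} → Graph n → VSet n → Fin n → ℕ
deg2In {n} G W u = sumFin n (λ w → if W w ∧ adj G u w then degIn G W w else 0)

deg : ∀ {n} → Graph n → Fin n → ℕ
deg {n} G = degIn G (λ _ → true)

degSum : ∀ {n} → Graph n → VSet n → ℕ
degSum {n} G W = sumFin n (λ w → if W w then deg G w else 0)

edgesIn : ∀ {n} → Graph n → VSet n → ℕ
edgesIn {n} G W = sumFin n (λ x → sumFin n (λ y →
  if (toℕ x <ᵇ toℕ y) ∧ W x ∧ W y ∧ adj G x y then 1 else 0))

edgeCount : ∀ {n} → Graph n → ℕ
edgeCount G = edgesIn G (λ _ → true)

module Submission where

-- Write R_k for the vertex set of G_{v_1,…,v_k}, so R_0 = V and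
-- R_{k+1} = R_k ∖ N[v_{k+1}], where the closed neighbourhood is taken in G.
-- Independence and injectivity of v give v_{k+1} ∈ R_k, so each step deletes
-- the closed neighbourhood N_H[u] of a vertex u of the induced subgraph H = G[R_k].
-- Two facts about one such deletion drive everything:
--   * it removes 1 + d_H(u) vertices;
--   * if G is triangle-free it removes exactly d²_H(u) edges: the neighbours of u
--     are pairwise non-adjacent, so Σ_{w ∼ u} d_H(w) counts every edge meeting
--     N_H[u] exactly once.
-- Telescoping over k = 0,…,r-1 gives both sums of the lemma.  The remaining
-- identities are the cut decompositions |E| = |E_W| + |E(W,W̄)| + |E_W̄| and
-- d(W) = 2|E_W| + |E(W,W̄)|, applied to W = B(S;1), whose complement is R_r.
-- Edges are counted through ordered adjacent pairs ("arcs"), which are easy to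
-- split along vertex sets; a symmetric irreflexive relation has exactly twice as
-- many ordered pairs as increasing ones, which converts arcs back into edges.

open import Defs hiding (sym)
open import Data.Nat using (ℕ; zero; suc; _+_; _∸_; _<ᵇ_; _<_)
open import Data.Nat.Properties
  using (+-identityʳ; +-comm; +-assoc; +-suc; +-cancelˡ-≡; +-cancelʳ-≡; suc-injective;
         m+n∸n≡m; m+n∸m≡n; <-cmp; <-irrefl; <⇒<ᵇ; <ᵇ⇒<)
open import Data.Nat.Tactic.RingSolver using (solve-∀)
open import Data.Fin using (Fin; zero; suc; toℕ; _≟_)
open import Data.Fin.Properties using (toℕ-injective)
open import Data.Bool using (Bool; true; false; _∧_; _∨_; not; if_then_else_)
open import Data.Bool.Properties
  using (∧-zeroʳ; ∧-idem; ∨-identityʳ; ∧-conicalʳ; ∧-distribʳ-∨; ∨-commutativeMonoid; ∧-commutativeMonoid;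
         ∨-∧-booleanAlgebra)
open import Algebra.Bundles using (CommutativeMonoid)
open import Algebra.Properties.CommutativeSemigroup
  (CommutativeMonoid.commutativeSemigroup ∨-commutativeMonoid)
  using () renaming (interchange to ∨-interchange)
open import Algebra.Properties.CommutativeSemigroup
  (CommutativeMonoid.commutativeSemigroup ∧-commutativeMonoid)
  using () renaming (x∙yz≈y∙xz to ∧-left-comm)
open import Algebra.Lattice.Properties.BooleanAlgebra ∨-∧-booleanAlgebra using (deMorgan₂)
open import Data.Product using (_×_; _,_)
open import Data.Empty using (⊥; ⊥-elim)
open import Function using (_∘_)
open import Function.Definitions using (Injective)
open import Relation.Nullary using (¬_; yes; no)
open import Relation.Nullary.Decidable using (⌊_⌋)
open import Relation.Binary.PropositionalEquality
  using (_≡_; refl; sym; trans; cong; cong₂; module ≡-Reasoning)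
open import Relation.Binary.Definitions using (tri<; tri≈; tri>)

open ≡-Reasoning

ind : Bool → ℕ
ind b = if b then 1 else 0

guard-ind : ∀ c a → (if c then ind a else 0) ≡ ind (c ∧ a)
guard-ind true  a = refl
guard-ind false a = refl

guard-split : ∀ w s (m : ℕ) →
  (if w then m else 0) ≡ (if w ∧ s then m else 0) + (if w ∧ not s then m else 0)
guard-split false s     m = refl
guard-split true  true  m = sym (+-identityʳ m)
guard-split true  false m = refl

ind-exclusive : ∀ r a b → (a ≡ true → b ≡ true → ⊥) → ind ((r ∧ a) ∧ b) ≡ 0
ind-exclusive false a     b     _ = refl
ind-exclusive true  false b     _ = refl
ind-exclusive true  true  false _ = refl
ind-exclusive true  true  true  h = ⊥-elim (h refl refl)

∨-absorbed : ∀ r b a → (r ∧ (b ∨ a)) ∧ a ≡ r ∧ a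
∨-absorbed false b     a = refl
∨-absorbed true  true  a = refl
∨-absorbed true  false a = ∧-idem a

<ᵇ-true : ∀ {m n} → m < n → (m <ᵇ n) ≡ true
<ᵇ-true {m} {n} m<n with m <ᵇ n | <⇒<ᵇ m<n
... | true | _ = refl

<ᵇ-false : ∀ {m n} → ¬ m < n → (m <ᵇ n) ≡ false
<ᵇ-false {m} {n} m≮n with m <ᵇ n | <ᵇ⇒< m n
... | false | _   = refl
... | true  | m<n = ⊥-elim (m≮n (m<n _))

≟-suc : ∀ {m} (j i : Fin m) → ⌊ suc j ≟ suc i ⌋ ≡ ⌊ j ≟ i ⌋
≟-suc j i with j ≟ i
... | yes _ = refl
... | no  _ = refl

toℕ-<ᵇ-suc : ∀ {m} (j i : Fin m) → (toℕ j <ᵇ suc (toℕ i)) ≡ (toℕ j <ᵇ toℕ i) ∨ ⌊ j ≟ i ⌋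
toℕ-<ᵇ-suc zero    zero    = refl
toℕ-<ᵇ-suc zero    (suc i) = refl
toℕ-<ᵇ-suc (suc j) zero    = refl
toℕ-<ᵇ-suc (suc j) (suc i) = trans (toℕ-<ᵇ-suc j i) (cong ((toℕ j <ᵇ toℕ i) ∨_) (sym (≟-suc j i)))

double-injective : ∀ a b → a + a ≡ b + b → a ≡ b
double-injective zero    zero    _  = refl
double-injective (suc a) (suc b) eq =
  cong suc (double-injective a b (suc-injective (begin
    suc (a + a) ≡⟨ sym (+-suc a a) ⟩
    a + suc a   ≡⟨ suc-injective eq ⟩
    b + suc b   ≡⟨ +-suc b b ⟩
    suc (b + b) ∎)))

sum-cong : ∀ n {f g : Fin n → ℕ} → (∀ x → f x ≡ g x) → sumFin n f ≡ sumFin n g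
sum-cong zero    h = refl
sum-cong (suc n) h = cong₂ _+_ (h zero) (sum-cong n (h ∘ suc))

sum-zero : ∀ n {f : Fin n → ℕ} → (∀ x → f x ≡ 0) → sumFin n f ≡ 0
sum-zero zero    h = refl
sum-zero (suc n) h = cong₂ _+_ (h zero) (sum-zero n (h ∘ suc))

sum-+ : ∀ n (f g : Fin n → ℕ) → sumFin n (λ x → f x + g x) ≡ sumFin n f + sumFin n g
sum-+ zero    f g = refl
sum-+ (suc n) f g = trans (cong ((f zero + g zero) +_) (sum-+ n (f ∘ suc) (g ∘ suc)))
                          (interchange (f zero) (g zero) _ _)
  where
  interchange : ∀ a b c d → (a + b) + (c + d) ≡ (a + c) + (b + d)
  interchange = solve-∀

sum-ones : ∀ n → sumFin n (λ _ → 1) ≡ n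
sum-ones zero    = refl
sum-ones (suc n) = cong suc (sum-ones n)

sum-point : ∀ n (u : Fin n) (f : Fin n → ℕ) → sumFin n (λ x → if ⌊ x ≟ u ⌋ then f x else 0) ≡ f u
sum-point (suc n) zero    f = trans (cong (f zero +_) (sum-zero n (λ _ → refl))) (+-identityʳ (f zero))
sum-point (suc n) (suc u) f =
  trans (sum-cong n (λ x → cong (λ b → if b then f (suc x) else 0) (≟-suc x u))) (sum-point n u (f ∘ suc))

sum-swap : ∀ n m (f : Fin n → Fin m → ℕ) →
  sumFin n (λ x → sumFin m (f x)) ≡ sumFin m (λ y → sumFin n (λ x → f x y))
sum-swap zero    m f = sym (sum-zero m (λ _ → refl))
sum-swap (suc n) m f = trans (cong (sumFin m (f zero) +_) (sum-swap n m (f ∘ suc)))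
                             (sym (sum-+ m (f zero) _))

guard-sum : ∀ n c (g : Fin n → ℕ) →
  (if c then sumFin n g else 0) ≡ sumFin n (λ y → if c then g y else 0)
guard-sum n true  g = refl
guard-sum n false g = sym (sum-zero n (λ _ → refl))

sum² : ∀ n → (Fin n → Fin n → ℕ) → ℕ
sum² n f = sumFin n (λ x → sumFin n (f x))

sum²-cong : ∀ n {f g : Fin n → Fin n → ℕ} → (∀ x y → f x y ≡ g x y) → sum² n f ≡ sum² n g
sum²-cong n h = sum-cong n (λ x → sum-cong n (h x))

sum²-+ : ∀ n {f g h : Fin n → Fin n → ℕ} → (∀ x y → f x y ≡ g x y + h x y) →
  sum² n f ≡ sum² n g + sum² n h
sum²-+ n split = trans (sum-cong n (λ x → trans (sum-cong n (split x)) (sum-+ n _ _))) (sum-+ n _ _)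

anyFin-cong : ∀ n {f g : Fin n → Bool} → (∀ x → f x ≡ g x) → anyFin n f ≡ anyFin n g
anyFin-cong zero    h = refl
anyFin-cong (suc n) h = cong₂ _∨_ (h zero) (anyFin-cong n (h ∘ suc))

anyFin-false : ∀ n {f : Fin n → Bool} → (∀ x → f x ≡ false) → anyFin n f ≡ false
anyFin-false zero    h = refl
anyFin-false (suc n) h = cong₂ _∨_ (h zero) (anyFin-false n (h ∘ suc))

anyFin-∨ : ∀ n (f g : Fin n → Bool) → anyFin n (λ x → f x ∨ g x) ≡ anyFin n f ∨ anyFin n g
anyFin-∨ zero    f g = refl
anyFin-∨ (suc n) f g = trans (cong ((f zero ∨ g zero) ∨_) (anyFin-∨ n (f ∘ suc) (g ∘ suc)))
                             (∨-interchange (f zero) (g zero) _ _)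

anyFin-point : ∀ n (u : Fin n) (f : Fin n → Bool) → anyFin n (λ x → ⌊ x ≟ u ⌋ ∧ f x) ≡ f u
anyFin-point (suc n) zero    f = trans (cong (f zero ∨_) (anyFin-false n (λ _ → refl))) (∨-identityʳ (f zero))
anyFin-point (suc n) (suc u) f =
  trans (anyFin-cong n (λ x → cong (_∧ f (suc x)) (≟-suc x u))) (anyFin-point n u (f ∘ suc))

full : ∀ {n} → VSet n
full _ = true

∁ : ∀ {n} → VSet n → VSet n
∁ W x = not (W x)

_∩_ : ∀ {n} → VSet n → VSet n → VSet n
(A ∩ B) x = A x ∧ B x

_∖_ : ∀ {n} → VSet n → VSet n → VSet n
(A ∖ B) x = A x ∧ not (B x)

sumOver : ∀ {n} → VSet n → (Fin n → ℕ) → ℕ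
sumOver {n} W f = sumFin n (λ x → if W x then f x else 0)

sumOver-cong : ∀ {n} (W : VSet n) {f g : Fin n → ℕ} → (∀ x → W x ≡ true → f x ≡ g x) →
  sumOver W f ≡ sumOver W g
sumOver-cong {n} W {f} {g} h = sum-cong n pointwise
  where
  pointwise : ∀ x → (if W x then f x else 0) ≡ (if W x then g x else 0)
  pointwise x with W x in Wx
  ... | true  = h x Wx
  ... | false = refl

sumOver-+ : ∀ {n} (W : VSet n) f g → sumOver W (λ x → f x + g x) ≡ sumOver W f + sumOver W g
sumOver-+ {n} W f g = trans (sum-cong n guarded-+) (sum-+ n _ _)
  where
  guarded-+ : ∀ x → (if W x then f x + g x else 0) ≡ (if W x then f x else 0) + (if W x then g x else 0)
  guarded-+ x with W x
  ... | true  = refl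
  ... | false = refl

sumOver-split : ∀ {n} (W S : VSet n) f → sumOver W f ≡ sumOver (W ∩ S) f + sumOver (W ∖ S) f
sumOver-split {n} W S f = trans (sum-cong n (λ x → guard-split (W x) (S x) (f x))) (sum-+ n _ _)

card-cong : ∀ {n} {W W′ : VSet n} → (∀ x → W x ≡ W′ x) → card W ≡ card W′
card-cong {n} h = sum-cong n (λ x → cong ind (h x))

edgesIn-cong : ∀ {n} (G : Graph n) {W W′ : VSet n} → (∀ x → W x ≡ W′ x) → edgesIn G W ≡ edgesIn G W′
edgesIn-cong {n} G h = sum²-cong n (λ x y →
  cong₂ (λ a b → ind ((toℕ x <ᵇ toℕ y) ∧ a ∧ b ∧ adj G x y)) (h x) (h y))

card-complement : ∀ {n} (W : VSet n) → card W + card (∁ W) ≡ n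
card-complement {n} W = trans (sym (sumOver-split full W (λ _ → 1))) (sum-ones n)

ordered-pairs-halve : ∀ n (Q : Fin n → Fin n → Bool) →
  (∀ x y → Q x y ≡ Q y x) → (∀ x → Q x x ≡ false) →
  sum² n (λ x y → ind (Q x y))
    ≡ sum² n (λ x y → ind ((toℕ x <ᵇ toℕ y) ∧ Q x y)) + sum² n (λ x y → ind ((toℕ x <ᵇ toℕ y) ∧ Q x y))
ordered-pairs-halve n Q Q-sym Q-irrefl =
  trans (sum²-+ n by-order) (cong (increasing +_) (sum-swap n n (λ x y → ind ((toℕ y <ᵇ toℕ x) ∧ Q y x))))
  where
  increasing : ℕ
  increasing = sum² n (λ x y → ind ((toℕ x <ᵇ toℕ y) ∧ Q x y))
  by-order : ∀ x y → ind (Q x y) ≡ ind ((toℕ x <ᵇ toℕ y) ∧ Q x y) + ind ((toℕ y <ᵇ toℕ x) ∧ Q y x)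
  by-order x y with <-cmp (toℕ x) (toℕ y)
  ... | tri< x<y _ y≮x rewrite <ᵇ-true x<y | <ᵇ-false y≮x = sym (+-identityʳ _)
  ... | tri> x≮y _ y<x rewrite <ᵇ-false x≮y | <ᵇ-true y<x | Q-sym x y = refl
  ... | tri≈ _ x≡y _ rewrite toℕ-injective x≡y | Q-irrefl y | <ᵇ-false (<-irrefl {toℕ y} refl) = refl

-- Arcs: ordered adjacent pairs between two vertex sets

module _ {n : ℕ} (G : Graph n) where

  -- arcs A B = #{(x,y) : x ∈ A, y ∈ B, x ∼ y} = Σ_{x ∈ A} d_B(x).
  -- In particular degSum G W = arcs W full and deg2In G R u = arcs (R ∩ adj G u) R.
  arcs : VSet n → VSet n → ℕ
  arcs A B = sumOver A (degIn G B)

  arcs-pairs : ∀ A B → arcs A B ≡ sum² n (λ x y → ind (A x ∧ B y ∧ adj G x y))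
  arcs-pairs A B = sum-cong n (λ x → trans (guard-sum n (A x) _)
                                          (sum-cong n (λ y → guard-ind (A x) (B y ∧ adj G x y))))

  arcs-sym : ∀ A B → arcs A B ≡ arcs B A
  arcs-sym A B = begin
    arcs A B                                                ≡⟨ arcs-pairs A B ⟩
    sum² n (λ x y → ind (A x ∧ B y ∧ adj G x y))            ≡⟨ sum-swap n n _ ⟩
    sum² n (λ y x → ind (A x ∧ B y ∧ adj G x y))            ≡⟨ sum²-cong n (λ y x → cong ind (reorder x y)) ⟩
    sum² n (λ y x → ind (B y ∧ A x ∧ adj G y x))            ≡⟨ sym (arcs-pairs B A) ⟩
    arcs B A                                                ∎
    where
    reorder : ∀ x y → A x ∧ B y ∧ adj G x y ≡ B y ∧ A x ∧ adj G y x
    reorder x y = trans (∧-left-comm (A x) (B y) _) (cong (λ e → B y ∧ A x ∧ e) (Graph.sym G x y))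

  arcs-splitˡ : ∀ A B S → arcs A B ≡ arcs (A ∩ S) B + arcs (A ∖ S) B
  arcs-splitˡ A B S = sumOver-split A S (degIn G B)

  arcs-splitʳ : ∀ A B S → arcs A B ≡ arcs A (B ∩ S) + arcs A (B ∖ S)
  arcs-splitʳ A B S = trans (sumOver-cong A (λ x _ → degIn-split x)) (sumOver-+ A _ _)
    where
    degIn-split : ∀ x → degIn G B x ≡ degIn G (B ∩ S) x + degIn G (B ∖ S) x
    degIn-split x = trans (sum-cong n split) (sum-+ n _ _)
      where
      split : ∀ y → ind (B y ∧ adj G x y) ≡ ind ((B y ∧ S y) ∧ adj G x y) + ind ((B y ∧ not (S y)) ∧ adj G x y)
      split y = begin
        ind (B y ∧ adj G x y)                                       ≡⟨ sym (guard-ind (B y) (adj G x y)) ⟩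
        (if B y then ind (adj G x y) else 0)                         ≡⟨ guard-split (B y) (S y) (ind (adj G x y)) ⟩
        (if B y ∧ S y then ind (adj G x y) else 0)
          + (if B y ∧ not (S y) then ind (adj G x y) else 0)        ≡⟨ cong₂ _+_ (guard-ind (B y ∧ S y) (adj G x y))
                                                                                 (guard-ind (B y ∧ not (S y)) (adj G x y)) ⟩
        ind ((B y ∧ S y) ∧ adj G x y) + ind ((B y ∧ not (S y)) ∧ adj G x y) ∎

  arcs-halve : ∀ W → arcs W W ≡ edgesIn G W + edgesIn G W
  arcs-halve W = trans (arcs-pairs W W) (ordered-pairs-halve n _ Q-sym Q-irrefl)
    where
    Q-sym : ∀ x y → W x ∧ W y ∧ adj G x y ≡ W y ∧ W x ∧ adj G y x
    Q-sym x y = trans (∧-left-comm (W x) (W y) _) (cong (λ e → W y ∧ W x ∧ e) (Graph.sym G x y))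
    Q-irrefl : ∀ x → W x ∧ W x ∧ adj G x x ≡ false
    Q-irrefl x rewrite irrefl G x | ∧-zeroʳ (W x) = ∧-zeroʳ (W x)

  arcs-four : ∀ A S → arcs A A ≡ (arcs (A ∩ S) (A ∩ S) + arcs (A ∩ S) (A ∖ S))
                                 + (arcs (A ∩ S) (A ∖ S) + arcs (A ∖ S) (A ∖ S))
  arcs-four A S = begin
    arcs A A                                      ≡⟨ arcs-splitˡ A A S ⟩
    arcs (A ∩ S) A + arcs (A ∖ S) A               ≡⟨ cong₂ _+_ (arcs-splitʳ (A ∩ S) A S) (arcs-splitʳ (A ∖ S) A S) ⟩
    (arcs (A ∩ S) (A ∩ S) + arcs (A ∩ S) (A ∖ S))
      + (arcs (A ∖ S) (A ∩ S) + arcs (A ∖ S) (A ∖ S))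
                                                  ≡⟨ cong (λ m → fromS + (m + arcs (A ∖ S) (A ∖ S))) (arcs-sym (A ∖ S) (A ∩ S)) ⟩
    fromS + (arcs (A ∩ S) (A ∖ S) + arcs (A ∖ S) (A ∖ S)) ∎
    where
    fromS : ℕ
    fromS = arcs (A ∩ S) (A ∩ S) + arcs (A ∩ S) (A ∖ S)

  -- |E| − |E_{V∖W}| = d(W) − |E_W|: both count the edges meeting W, namely
  -- |E_W| + |E(W, V∖W)|.
  edges-meeting : ∀ W → edgeCount G ∸ edgesIn G (∁ W) ≡ degSum G W ∸ edgesIn G W
  edges-meeting W = begin
    edgeCount G ∸ ē          ≡⟨ cong (_∸ ē) edgeCount-cut ⟩
    (e + c) + ē ∸ ē          ≡⟨ m+n∸n≡m (e + c) ē ⟩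
    e + c                    ≡⟨ sym (m+n∸m≡n e (e + c)) ⟩
    e + (e + c) ∸ e          ≡⟨ cong (_∸ e) (sym degSum-cut) ⟩
    degSum G W ∸ e           ∎
    where
    e ē c : ℕ
    e = edgesIn G W
    ē = edgesIn G (∁ W)
    c = arcs W (∁ W)
    degSum-cut : degSum G W ≡ e + (e + c)
    degSum-cut = trans (arcs-splitʳ W full W)
                       (trans (cong (_+ c) (arcs-halve W)) (+-assoc e e c))
    edgeCount-cut : edgeCount G ≡ (e + c) + ē
    edgeCount-cut = double-injective _ _ (begin
      edgeCount G + edgeCount G          ≡⟨ sym (arcs-halve full) ⟩
      arcs full full                     ≡⟨ arcs-four full W ⟩
      (arcs W W + c) + (c + arcs (∁ W) (∁ W))
                                         ≡⟨ cong₂ (λ a b → (a + c) + (c + b)) (arcs-halve W) (arcs-halve (∁ W)) ⟩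
      ((e + e) + c) + (c + (ē + ē))      ≡⟨ regroup e c ē ⟩
      ((e + c) + ē) + ((e + c) + ē)      ∎)
      where
      regroup : ∀ e c ē → ((e + e) + c) + (c + (ē + ē)) ≡ ((e + c) + ē) + ((e + c) + ē)
      regroup = solve-∀

-- Deleting a closed neighbourhood

module _ {n : ℕ} (G : Graph n) where

  closedNbhd : Fin n → VSet n
  closedNbhd u x = ⌊ x ≟ u ⌋ ∨ adj G u x

  sumOver-closedNbhd : ∀ (R : VSet n) u → R u ≡ true → ∀ f →
    sumOver (R ∩ closedNbhd u) f ≡ f u + sumOver (R ∩ adj G u) f
  sumOver-closedNbhd R u Ru f =
    trans (sum-cong n centre-or-neighbour) (trans (sum-+ n _ _) (cong (_+ sumOver (R ∩ adj G u) f) (sum-point n u f)))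
    where
    centre-or-neighbour : ∀ x → (if R x ∧ (⌊ x ≟ u ⌋ ∨ adj G u x) then f x else 0)
                              ≡ (if ⌊ x ≟ u ⌋ then f x else 0) + (if R x ∧ adj G u x then f x else 0)
    centre-or-neighbour x with x ≟ u
    ... | yes refl rewrite Ru | irrefl G x = sym (+-identityʳ (f x))
    ... | no _ = refl

  card-deleteNbhd : ∀ (R : VSet n) u → R u ≡ true →
    card R ≡ card (R ∖ closedNbhd u) + (1 + degIn G R u)
  card-deleteNbhd R u Ru = begin
    card R                                                      ≡⟨ sumOver-split R (closedNbhd u) (λ _ → 1) ⟩
    sumOver (R ∩ closedNbhd u) (λ _ → 1) + card (R ∖ closedNbhd u)
                                                                ≡⟨ cong (_+ card (R ∖ closedNbhd u)) (sumOver-closedNbhd R u Ru (λ _ → 1)) ⟩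
    (1 + degIn G R u) + card (R ∖ closedNbhd u)                 ≡⟨ +-comm (1 + degIn G R u) (card (R ∖ closedNbhd u)) ⟩
    card (R ∖ closedNbhd u) + (1 + degIn G R u)                 ∎

  module _ (triangleFree : TriangleFree G) (R : VSet n) (u : Fin n) (Ru : R u ≡ true) where

    private
      S R′ : VSet n
      S  = R ∩ closedNbhd u
      R′ = R ∖ closedNbhd u

    degIn-neighbour : ∀ x → adj G u x ≡ true → degIn G S x ≡ 1
    degIn-neighbour x ux = trans (sum-cong n only-u) (sum-point n u (λ _ → 1))
      where
      only-u : ∀ y → ind ((R y ∧ (⌊ y ≟ u ⌋ ∨ adj G u y)) ∧ adj G x y) ≡ (if ⌊ y ≟ u ⌋ then 1 else 0)
      only-u y with y ≟ u
      ... | yes refl rewrite Ru | Graph.sym G x y | ux = refl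
      ... | no _ = ind-exclusive (R y) (adj G u y) (adj G x y) (λ uy xy → triangleFree u x y ux xy uy)

    degIn-centre : degIn G S u ≡ degIn G R u
    degIn-centre = sum-cong n (λ y → cong ind (∨-absorbed (R y) ⌊ y ≟ u ⌋ (adj G u y)))

    arcs-closedNbhd : arcs G S S ≡ degIn G R u + degIn G R u
    arcs-closedNbhd = begin
      arcs G S S                                          ≡⟨ sumOver-closedNbhd R u Ru (degIn G S) ⟩
      degIn G S u + sumOver (R ∩ adj G u) (degIn G S)     ≡⟨ cong₂ _+_ degIn-centre (sumOver-cong (R ∩ adj G u)
                                                               (λ x Rx∧ux → degIn-neighbour x (∧-conicalʳ (R x) _ Rx∧ux))) ⟩
      degIn G R u + degIn G R u                           ∎

    edges-deleteNbhd : edgesIn G R ≡ edgesIn G R′ + deg2In G R u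
    edges-deleteNbhd = double-injective _ _ (begin
      edgesIn G R + edgesIn G R             ≡⟨ sym (arcs-halve G R) ⟩
      arcs G R R                            ≡⟨ arcs-four G R (closedNbhd u) ⟩
      (s + m) + (m + arcs G R′ R′)          ≡⟨ cong₂ (λ a b → (a + m) + (m + b)) arcs-closedNbhd (arcs-halve G R′) ⟩
      ((d + d) + m) + (m + (e′ + e′))       ≡⟨ regroup d m e′ ⟩
      (e′ + (d + m)) + (e′ + (d + m))       ≡⟨ cong (λ t → (e′ + t) + (e′ + t)) d+m≡q ⟩
      (e′ + q) + (e′ + q)                   ∎)
      where
      d q s m e′ : ℕ
      d  = degIn G R u
      q  = deg2In G R u
      s  = arcs G S S
      m  = arcs G S R′
      e′ = edgesIn G R′
      s+m≡d+q : s + m ≡ d + q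
      s+m≡d+q = trans (sym (arcs-splitʳ G S R (closedNbhd u))) (sumOver-closedNbhd R u Ru (degIn G R))
      d+m≡q : d + m ≡ q
      d+m≡q = +-cancelˡ-≡ d _ _ (begin
        d + (d + m) ≡⟨ sym (+-assoc d d m) ⟩
        (d + d) + m ≡⟨ cong (_+ m) (sym arcs-closedNbhd) ⟩
        s + m       ≡⟨ s+m≡d+q ⟩
        d + q       ∎)
      regroup : ∀ d m e → ((d + d) + m) + (m + (e + e)) ≡ (e + (d + m)) + (e + (d + m))
      regroup = solve-∀

telescope : ∀ r (f : ℕ → ℕ) (g : Fin r → ℕ) →
  (∀ i → f (toℕ i) ≡ f (suc (toℕ i)) + g i) → f 0 ≡ f r + sumFin r g
telescope zero    f g step = sym (+-identityʳ (f 0))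
telescope (suc r) f g step = begin
  f 0                                       ≡⟨ step zero ⟩
  f 1 + g zero                              ≡⟨ cong (_+ g zero) (telescope r (f ∘ suc) (g ∘ suc) (step ∘ suc)) ⟩
  (f (suc r) + sumFin r (g ∘ suc)) + g zero ≡⟨ +-assoc (f (suc r)) _ _ ⟩
  f (suc r) + (sumFin r (g ∘ suc) + g zero) ≡⟨ cong (f (suc r) +_) (+-comm _ (g zero)) ⟩
  f (suc r) + sumFin (suc r) g              ∎

-- The greedy sequence G = G_∅ ⊇ G_{v_1} ⊇ G_{v_1,v_2} ⊇ …

module Greedy {n r : ℕ} (G : Graph n) (v : Fin r → Fin n) where

  remaining-zero : ∀ x → remaining G v 0 x ≡ true
  remaining-zero x = cong not (anyFin-false r (λ _ → refl))

  ball-step : ∀ i x → ball G v (suc (toℕ i)) x ≡ ball G v (toℕ i) x ∨ closedNbhd G (v i) x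
  ball-step i x = begin
    anyFin r (λ j → (toℕ j <ᵇ suc (toℕ i)) ∧ c j)
      ≡⟨ anyFin-cong r (λ j → trans (cong (_∧ c j) (toℕ-<ᵇ-suc j i)) (∧-distribʳ-∨ (c j) (toℕ j <ᵇ toℕ i) ⌊ j ≟ i ⌋)) ⟩
    anyFin r (λ j → ((toℕ j <ᵇ toℕ i) ∧ c j) ∨ (⌊ j ≟ i ⌋ ∧ c j))
      ≡⟨ anyFin-∨ r _ _ ⟩
    ball G v (toℕ i) x ∨ anyFin r (λ j → ⌊ j ≟ i ⌋ ∧ c j)
      ≡⟨ cong (ball G v (toℕ i) x ∨_) (anyFin-point r i c) ⟩
    ball G v (toℕ i) x ∨ c i
      ∎
    where
    c : Fin r → Bool
    c j = closedNbhd G (v j) x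

  remaining-step : ∀ i x → remaining G v (suc (toℕ i)) x ≡ (remaining G v (toℕ i) ∖ closedNbhd G (v i)) x
  remaining-step i x = trans (cong not (ball-step i x)) (deMorgan₂ (ball G v (toℕ i) x) (closedNbhd G (v i) x))

  module _ (inj : Injective _≡_ _≡_ v) (indep : ∀ i j → adj G (v i) (v j) ≡ false) where

    centre-remaining : ∀ i → remaining G v (toℕ i) (v i) ≡ true
    centre-remaining i = cong not (anyFin-false r earlier-miss)
      where
      earlier-miss : ∀ j → (toℕ j <ᵇ toℕ i) ∧ (⌊ v i ≟ v j ⌋ ∨ adj G (v j) (v i)) ≡ false
      earlier-miss j rewrite indep j i with v i ≟ v j
      ... | no _ = ∧-zeroʳ _
      ... | yes vi≡vj with inj vi≡vj
      ...   | refl = cong (_∧ true) (<ᵇ-false (<-irrefl {toℕ i} refl))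

    card-step : ∀ i → card (remaining G v (toℕ i))
                    ≡ card (remaining G v (suc (toℕ i))) + (1 + degIn G (remaining G v (toℕ i)) (v i))
    card-step i = trans (card-deleteNbhd G (remaining G v (toℕ i)) (v i) (centre-remaining i))
                        (cong (_+ (1 + degIn G (remaining G v (toℕ i)) (v i))) (card-cong (λ x → sym (remaining-step i x))))

    edges-step : TriangleFree G → ∀ i → edgesIn G (remaining G v (toℕ i))
                    ≡ edgesIn G (remaining G v (suc (toℕ i))) + deg2In G (remaining G v (toℕ i)) (v i)
    edges-step triangleFree i = trans (edges-deleteNbhd G triangleFree (remaining G v (toℕ i)) (v i) (centre-remaining i))
                                      (cong (_+ deg2In G (remaining G v (toℕ i)) (v i)) (edgesIn-cong G (λ x → sym (remaining-step i x))))

    vertices-telescope : n ≡ card (remaining G v r)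
                             + (r + sumFin r (λ i → degIn G (remaining G v (toℕ i)) (v i)))
    vertices-telescope = begin
      n                                         ≡⟨ sym (trans (card-cong remaining-zero) (sum-ones n)) ⟩
      card (remaining G v 0)                    ≡⟨ telescope r (card ∘ remaining G v) (λ i → 1 + d i) card-step ⟩
      card (remaining G v r) + sumFin r (λ i → 1 + d i)
                                                ≡⟨ cong (card (remaining G v r) +_) (trans (sum-+ r (λ _ → 1) d)
                                                                                 (cong (_+ sumFin r d) (sum-ones r))) ⟩
      card (remaining G v r) + (r + sumFin r d) ∎
      where
      d : Fin r → ℕ
      d i = degIn G (remaining G v (toℕ i)) (v i)

    edges-telescope : TriangleFree G →
      edgeCount G ≡ edgesIn G (remaining G v r) + sumFin r (λ i → deg2In G (remaining G v (toℕ i)) (v i))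
    edges-telescope triangleFree =
      trans (edgesIn-cong G (λ x → sym (remaining-zero x)))
            (telescope r (edgesIn G ∘ remaining G v) _ (edges-step triangleFree))

lemma2p5 : ∀ {n r} (G : Graph n) → TriangleFree G →
    (v : Fin r → Fin n) → Injective _≡_ _≡_ v →
    (∀ i j → adj G (v i) (v j) ≡ false) →
    ((n ∸ card (remaining G v r) ≡ card (ball G v r))
      × (card (ball G v r) ≡ r + sumFin r (λ i → degIn G (remaining G v (toℕ i)) (v i))))
    × ((edgeCount G ∸ edgesIn G (remaining G v r) ≡ degSum G (ball G v r) ∸ edgesIn G (ball G v r))
      × (degSum G (ball G v r) ∸ edgesIn G (ball G v r) ≡ sumFin r (λ i → deg2In G (remaining G v (toℕ i)) (v i))))
lemma2p5 {n} {r} G triangleFree v inj indep =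
  (vertices-removed , ball-size) , (edges-meeting G B , edges-removed)
  where
  open Greedy G v
  B : VSet n
  B = ball G v r

  vertices-removed : n ∸ card (∁ B) ≡ card B
  vertices-removed = trans (cong (_∸ card (∁ B)) (sym (card-complement B))) (m+n∸n≡m (card B) (card (∁ B)))

  ball-size : card B ≡ r + sumFin r (λ i → degIn G (remaining G v (toℕ i)) (v i))
  ball-size = +-cancelʳ-≡ (card (∁ B)) _ _
    (trans (card-complement B) (trans (vertices-telescope inj indep) (+-comm (card (∁ B)) _)))

  Σd² : ℕ
  Σd² = sumFin r (λ i → deg2In G (remaining G v (toℕ i)) (v i))

  edges-removed : degSum G B ∸ edgesIn G B ≡ Σd²
  edges-removed = begin
    degSum G B ∸ edgesIn G B                ≡⟨ sym (edges-meeting G B) ⟩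
    edgeCount G ∸ edgesIn G (∁ B)           ≡⟨ cong (_∸ edgesIn G (∁ B)) (edges-telescope inj indep triangleFree) ⟩
    edgesIn G (∁ B) + Σd² ∸ edgesIn G (∁ B) ≡⟨ m+n∸m≡n (edgesIn G (∁ B)) Σd² ⟩
    Σd²                                     ∎
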